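{- For an integer $n\geq 10$, Left will win the cycle position $C_n$ in the Mutual Failures Variant regardless of which player moves first.
   Context: The Mutual Failures Variant of the Mixed Deletion Game is a partisan combinatorial game played on a finite simple undirected graph by two players, Left and Right, who alternate turns. On her turn Left deletes one vertex together with all its incident edges; on his turn Right deletes one edge. A deletion that would create an isolated vertex ends the game and the player who made it loses (so such deletions are effectively unavailable). In addition, the Mutual Failures Variant imposes the condition that in any graph position Right has no available move if and only if Left has no available move. $C_n$ denotes the game position on the cycle graph with $n$ vertices. -}

module Defs where

open import Data.Nat using (ℕ; zero; suc; _≡ᵇ_)
open import Data.Fin using (Fin; toℕ; _≟_)
open import Data.Bool using (Bool; true; false; _∧_; _∨_; not)
open import Data.Product using (Σ; ∃; ∃-syntax; _×_; _,_)
open import Data.Sum using (_⊎_)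
open import Relation.Nullary using (¬_)
open import Relation.Nullary.Decidable using (⌊_⌋)
open import Relation.Binary.PropositionalEquality using (_≡_)

-- V says which vertices are still present, E is the
-- (symmetric, irreflexive) edge relation among present vertices.

record Pos (m : ℕ) : Set where
  constructor pos
  field
    V : Fin m → Bool
    E : Fin m → Fin m → Bool
open Pos public

_==_ : {m : ℕ} → Fin m → Fin m → Bool
x == y = ⌊ x ≟ y ⌋

delV : {m : ℕ} → Pos m → Fin m → Pos m
delV G v = pos (λ x → V G x ∧ not (x == v))
               (λ x y → E G x y ∧ not (x == v) ∧ not (y == v))

delE : {m : ℕ} → Pos m → Fin m → Fin m → Pos m
delE G u v = pos (V G)
                 (λ x y → E G x y ∧ not ((x == u ∧ y == v) ∨ (x == v ∧ y == u)))

-- u has a neighbour different from w (i.e. u is not left isolated when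
-- its edge to w, resp. the vertex w, is deleted).
HasOtherNbr : {m : ℕ} → Pos m → Fin m → Fin m → Set
HasOtherNbr G u w = ∃[ x ] (¬ (x ≡ w) × E G u x ≡ true)

LeftAvail : {m : ℕ} → Pos m → Fin m → Set
LeftAvail G v = V G v ≡ true × (∀ u → E G v u ≡ true → HasOtherNbr G u v)

RightAvail : {m : ℕ} → Pos m → Fin m → Fin m → Set
RightAvail G u v = E G u v ≡ true × HasOtherNbr G u v × HasOtherNbr G v u

LeftHasMove : {m : ℕ} → Pos m → Set
LeftHasMove G = ∃[ v ] LeftAvail G v

RightHasMove : {m : ℕ} → Pos m → Set
RightHasMove G = ∃[ u ] ∃[ v ] RightAvail G u v

-- Mutual Failures Variant: a position is terminal for both players as soon
-- as either player lacks an available move; the player to move at a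
-- terminal position loses.
--   LeftWinsL G : Left wins G with Left to move.
--   LeftWinsR G : Left wins G with Right to move.

data LeftWinsL {m : ℕ} : Pos m → Set
data LeftWinsR {m : ℕ} : Pos m → Set

data LeftWinsL {m} where
  leftMove : {G : Pos m} → RightHasMove G →
             (v : Fin m) → LeftAvail G v → LeftWinsR (delV G v) → LeftWinsL G

data LeftWinsR {m} where
  leftStuck : {G : Pos m} → ¬ LeftHasMove G → LeftWinsR G
  allRight  : {G : Pos m} →
              (∀ u v → RightAvail G u v → LeftWinsL (delE G u v)) → LeftWinsR G

cycAdj : ℕ → ℕ → ℕ → Bool
cycAdj n a b = (suc a ≡ᵇ b) ∨ (suc b ≡ᵇ a)
             ∨ ((a ≡ᵇ 0) ∧ (suc b ≡ᵇ n)) ∨ ((b ≡ᵇ 0) ∧ (suc a ≡ᵇ n))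

C : (n : ℕ) → Pos n
C n = pos (λ _ → true) (λ i j → cycAdj n (toℕ i) (toℕ j))

-- A position reached from a cycle is a disjoint union of paths, and both kinds of move act on a
-- single path: Left deletes an end vertex or an inner vertex leaving two paths of at least two
-- vertices, Right cuts a path into two paths of at least two vertices.  Paths with at most two
-- vertices are dead, so a position is summarised by how many of its paths have 3, 4, …, 8 and at
-- least 9 vertices.  Left wins with Left to move unless no path has four or more vertices or the
-- profile is exactly {4,4}, and with Right to move unless it is {4}, {5} or {6} with any number of 3s,
-- or exactly {8}, {4,4,4} or {4,6}.  Indeed a cut can only produce one of the first exceptions from one
-- of the second, and Left always avoids the second list: she deletes an end vertex of a longest path,
-- and in the few profiles where this lands in the list a different deletion works.  After the first
-- move on C n, n ≥ 10, a single path with n - 1 or n vertices remains, which is on neither list.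
--
-- The graphs are tracked through a numbering of their vertices by positions 0, 1, … (a rotation of
-- the cycle), under which the current graph is a sequence of paths on consecutive positions.

module Submission where

open import Defs
open import Data.Bool using (Bool; true; false; _∧_; _∨_; not; if_then_else_)
import Data.Bool.Properties
open import Data.Empty using (⊥-elim)
open import Data.Fin using (Fin; toℕ; fromℕ<; _≟_)
open import Data.Fin.Properties using (toℕ-fromℕ<; toℕ-injective; toℕ<n)
open import Data.List using (List; []; _∷_; _++_; map)
open import Data.List.Membership.Propositional using (_∈_)
open import Data.List.Membership.Propositional.Properties using (∈-∃++)
import Data.List.Properties
open import Data.List.Relation.Unary.Any using (here; there)
open import Data.Nat
  using (ℕ; zero; suc; _+_; _∸_; _≤_; _<_; z≤n; s≤s; _≡ᵇ_; _<ᵇ_; pred; _%_; NonZero; >-nonZero⁻¹)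
open import Data.Nat.DivMod using (m<n⇒m%n≡m; n%n≡0; m%n<n; %-distribˡ-+; m%n%n≡m%n; [m+n]%n≡m%n)
open import Data.Nat.ListAction using (sum)
import Data.Nat.ListAction.Properties
import Data.Nat.Properties as ℕ
open import Algebra.Properties.CommutativeSemigroup ℕ.+-commutativeSemigroup using (x∙yz≈y∙xz)
open import Data.Product using (Σ; ∃; ∃-syntax; _×_; _,_; proj₁; proj₂)
open import Data.Product.Function.NonDependent.Propositional using (_×-⇔_)
open import Data.Sum using (_⊎_; inj₁; inj₂)
open import Data.Sum.Function.Propositional using (_⊎-⇔_)
open import Function using (_⇔_; mk⇔; Equivalence; _∘_)
open import Function.Properties.Equivalence using () renaming (sym to ⇔-sym; trans to ⇔-trans)
open import Relation.Binary.PropositionalEquality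
open import Relation.Nullary using (¬_; Dec; yes; no; does)

open Equivalence using (to; from)

∧-≡true : ∀ {a b} → (a ∧ b) ≡ true ⇔ (a ≡ true × b ≡ true)
∧-≡true {true}  = mk⇔ (refl ,_) proj₂
∧-≡true {false} = mk⇔ (λ ()) (λ { (() , _) })

∨-≡true : ∀ {a b} → (a ∨ b) ≡ true ⇔ (a ≡ true ⊎ b ≡ true)
∨-≡true {true}  = mk⇔ inj₁ (λ _ → refl)
∨-≡true {false} = mk⇔ inj₂ (λ { (inj₁ ()) ; (inj₂ h) → h })

not-≡true : ∀ {a} → not a ≡ true ⇔ (¬ a ≡ true)
not-≡true {true}  = mk⇔ (λ ()) (λ ¬t → ⊥-elim (¬t refl))
not-≡true {false} = mk⇔ (λ _ ()) (λ _ → refl)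

does-≡true : ∀ {P : Set} (d : Dec P) → does d ≡ true ⇔ P
does-≡true (yes p) = mk⇔ (λ _ → p) (λ _ → refl)
does-≡true (no ¬p) = mk⇔ (λ ()) (λ p → ⊥-elim (¬p p))

==-≡true : ∀ {m} (x y : Fin m) → (x == y) ≡ true ⇔ x ≡ y
==-≡true x y with x ≟ y
... | yes e = mk⇔ (λ _ → e) (λ _ → refl)
... | no ne = mk⇔ (λ ()) (λ e → ⊥-elim (ne e))

not-==-≡true : ∀ {m} (x y : Fin m) → not (x == y) ≡ true ⇔ x ≢ y
not-==-≡true x y with x ≟ y
... | yes e = mk⇔ (λ ()) (λ ne → ⊥-elim (ne e))
... | no ne = mk⇔ (λ _ → ne) (λ _ → refl)

true≢false : true ≢ false
true≢false ()

≡ᵇ-≡true : ∀ {m n} → (m ≡ᵇ n) ≡ true ⇔ m ≡ n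
≡ᵇ-≡true {m} {n} = does-≡true (m ℕ.≟ n)

not-≡ᵇ-≡true : ∀ {m n} → not (m ≡ᵇ n) ≡ true ⇔ m ≢ n
not-≡ᵇ-≡true = mk⇔ (λ h e → to not-≡true h (from ≡ᵇ-≡true e))
                   (λ ne → from not-≡true (λ t → ne (to ≡ᵇ-≡true t)))

SamePair : {A : Set} → A → A → A → A → Set
SamePair a b p q = (p ≡ a × q ≡ b) ⊎ (p ≡ b × q ≡ a)

SamePair-sym : {A : Set} {a b p q : A} → SamePair a b p q → SamePair b a p q
SamePair-sym (inj₁ e) = inj₂ e
SamePair-sym (inj₂ e) = inj₁ e

SamePair-map : {X Y : Set} (f : X → Y) {a b p q : X} →
               SamePair a b p q → SamePair (f a) (f b) (f p) (f q)
SamePair-map f = Data.Sum.map (Data.Product.map (cong f) (cong f)) (Data.Product.map (cong f) (cong f))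

SamePair-unmap : {X Y : Set} {f : X → Y} → (∀ {s t} → f s ≡ f t → s ≡ t) → {a b p q : X} →
                 SamePair (f a) (f b) (f p) (f q) → SamePair a b p q
SamePair-unmap inj = Data.Sum.map (Data.Product.map inj inj) (Data.Product.map inj inj)

E-delV : ∀ {m} (G : Pos m) v x y →
         E (delV G v) x y ≡ true ⇔ (E G x y ≡ true × x ≢ v × y ≢ v)
E-delV G v x y = mk⇔
  (λ h → let h₁ , h₂ = to ∧-≡true h ; h₃ , h₄ = to ∧-≡true h₂ in
         h₁ , to (not-==-≡true x v) h₃ , to (not-==-≡true y v) h₄)
  (λ (h₁ , x≢v , y≢v) → from ∧-≡true (h₁ , from ∧-≡true
     (from (not-==-≡true x v) x≢v , from (not-==-≡true y v) y≢v)))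

E-delE : ∀ {m} (G : Pos m) u v x y →
         E (delE G u v) x y ≡ true ⇔ (E G x y ≡ true × ¬ SamePair u v x y)
E-delE G u v x y = mk⇔
  (λ h → let h₁ , h₂ = to ∧-≡true h in h₁ , λ s → to not-≡true h₂ (from pair⇔ s))
  (λ (h₁ , ¬s) → from ∧-≡true (h₁ , from not-≡true (λ p → ¬s (to pair⇔ p))))
  where
  both : ∀ a b → (x == a ∧ y == b) ≡ true ⇔ (x ≡ a × y ≡ b)
  both a b = mk⇔
    (λ h → let h₁ , h₂ = to ∧-≡true h in to (==-≡true x a) h₁ , to (==-≡true y b) h₂)
    (λ (e₁ , e₂) → from ∧-≡true (from (==-≡true x a) e₁ , from (==-≡true y b) e₂))
  pair⇔ : ((x == u ∧ y == v) ∨ (x == v ∧ y == u)) ≡ true ⇔ SamePair u v x y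
  pair⇔ = mk⇔
    (λ h → Data.Sum.map (to (both u v)) (to (both v u)) (to ∨-≡true h))
    (λ s → from ∨-≡true (Data.Sum.map (from (both u v)) (from (both v u)) s))

Rel : Set₁
Rel = ℕ → ℕ → Set

_─ᵛ_ : Rel → ℕ → Rel
(A ─ᵛ z) p q = A p q × p ≢ z × q ≢ z

_─ᵉ_ : Rel → ℕ × ℕ → Rel
(A ─ᵉ (a , b)) p q = A p q × ¬ SamePair a b p q

─ᵉ-cong : ∀ {A a b c d} → SamePair a b c d → ∀ p q → (A ─ᵉ (c , d)) p q ⇔ (A ─ᵉ (a , b)) p q
─ᵉ-cong (inj₁ (refl , refl)) p q = mk⇔ (λ x → x) (λ x → x)
─ᵉ-cong (inj₂ (refl , refl)) p q =
  mk⇔ (λ (h , ¬s) → h , λ s → ¬s (SamePair-sym s)) (λ (h , ¬s) → h , λ s → ¬s (SamePair-sym s))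

HasOtherNbr′ : Rel → ℕ → ℕ → Set
HasOtherNbr′ A p w = ∃[ q ] (q ≢ w × A p q)

LeftAvail′ : Rel → ℕ → Set
LeftAvail′ A z = (∃[ q ] A z q) × (∀ q → A z q → HasOtherNbr′ A q z)

RightAvail′ : Rel → ℕ → ℕ → Set
RightAvail′ A p q = A p q × HasOtherNbr′ A p q × HasOtherNbr′ A q p

Bounded : ℕ → Rel → Set
Bounded m A = ∀ {p q} → A p q → p < m × q < m

WellFormed : ∀ {m} → Pos m → Set
WellFormed G = ∀ x y → E G x y ≡ true → V G x ≡ true

wellFormed-delV : ∀ {m} {G : Pos m} v → WellFormed G → WellFormed (delV G v)
wellFormed-delV {G = G} v wf x y h =
  let h₁ , x≢v , _ = to (E-delV G v x y) h
  in from ∧-≡true (wf x y h₁ , from (not-==-≡true x v) x≢v)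

wellFormed-delE : ∀ {m} {G : Pos m} u v → WellFormed G → WellFormed (delE G u v)
wellFormed-delE {G = G} u v wf x y h = wf x y (proj₁ (to (E-delE G u v x y) h))

record Frame (m : ℕ) : Set where
  field
    index : Fin m → ℕ
    vertex : ℕ → Fin m
    vertex-index : ∀ x → vertex (index x) ≡ x
    index-vertex : ∀ {p} → p < m → index (vertex p) ≡ p

  index-injective : ∀ {x y} → index x ≡ index y → x ≡ y
  index-injective {x} {y} e = trans (sym (vertex-index x)) (trans (cong vertex e) (vertex-index y))

record Represents {m} (F : Frame m) (A : Rel) (G : Pos m) : Set where
  constructor mkRepresents
  field edges⇔ : ∀ x y → E G x y ≡ true ⇔ A (Frame.index F x) (Frame.index F y)

module _ {m} (F : Frame m) where
  open Frame F

  represents-cong : ∀ {A B G} → (∀ x y → A (index x) (index y) ⇔ B (index x) (index y)) →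
                    Represents F A G → Represents F B G
  represents-cong A⇔B (mkRepresents R) = mkRepresents λ x y → ⇔-trans (R x y) (A⇔B x y)

  represents-delV : ∀ {A G} v → Represents F A G → Represents F (A ─ᵛ index v) (delV G v)
  represents-delV {G = G} v (mkRepresents R) = mkRepresents λ x y → mk⇔
    (λ h → let h₁ , x≢v , y≢v = to (E-delV G v x y) h
           in to (R x y) h₁ , (λ e → x≢v (index-injective e)) , (λ e → y≢v (index-injective e)))
    (λ (a , x≢v , y≢v) → from (E-delV G v x y)
                           (from (R x y) a , (λ e → x≢v (cong index e)) , (λ e → y≢v (cong index e))))

  represents-delE : ∀ {A G} u v → Represents F A G → Represents F (A ─ᵉ (index u , index v)) (delE G u v)
  represents-delE {G = G} u v (mkRepresents R) = mkRepresents λ x y → mk⇔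
    (λ h → let h₁ , ¬s = to (E-delE G u v x y) h
           in to (R x y) h₁ , λ s → ¬s (SamePair-unmap index-injective s))
    (λ (a , ¬s) → from (E-delE G u v x y) (from (R x y) a , λ s → ¬s (SamePair-map index s)))

  open Represents

  atVertices : ∀ (P : Rel) {p q} → p < m → q < m → P p q → P (index (vertex p)) (index (vertex q))
  atVertices P p<m q<m = subst₂ P (sym (index-vertex p<m)) (sym (index-vertex q<m))

  hasOtherNbr : ∀ {A G} → Represents F A G → Bounded m A →
                ∀ u w → HasOtherNbr′ A (index u) (index w) → HasOtherNbr G u w
  hasOtherNbr {A} R bd u w (q , q≢w , a) =
    vertex q , (λ e → q≢w (trans (sym q≡) (cong index e)))
    , from (edges⇔ R u (vertex q)) (subst (A (index u)) (sym q≡) a)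
    where q≡ = index-vertex (proj₂ (bd a))

  leftAvail : ∀ {A G} → WellFormed G → Represents F A G → Bounded m A →
              ∀ v → LeftAvail′ A (index v) → LeftAvail G v
  leftAvail {A} wf R bd v ((q , a) , others) =
    wf v (vertex q) (from (edges⇔ R v (vertex q)) (subst (A (index v)) (sym (index-vertex (proj₂ (bd a)))) a))
    , λ u h → hasOtherNbr R bd u v (others (index u) (to (edges⇔ R v u) h))

  rightAvail′ : ∀ {A G} → Represents F A G → ∀ {u v} → RightAvail G u v → RightAvail′ A (index u) (index v)
  rightAvail′ {A} {G} R {u} {v} (h , ou , ov) = to (edges⇔ R u v) h , other ou , other ov
    where
    other : ∀ {a b} → HasOtherNbr G a b → HasOtherNbr′ A (index a) (index b)
    other {a} (x , x≢b , e) = index x , (λ e′ → x≢b (index-injective e′)) , to (edges⇔ R a x) e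

  rightHasMove : ∀ {A G} → Represents F A G → Bounded m A → ∀ {p q} → RightAvail′ A p q → RightHasMove G
  rightHasMove {A} R bd {p} {q} (a , op , oq) =
    vertex p , vertex q
    , from (edges⇔ R (vertex p) (vertex q)) (atVertices A p<m q<m a)
    , hasOtherNbr R bd (vertex p) (vertex q) (atVertices (HasOtherNbr′ A) p<m q<m op)
    , hasOtherNbr R bd (vertex q) (vertex p) (atVertices (HasOtherNbr′ A) q<m p<m oq)
    where
    p<m = proj₁ (bd a)
    q<m = proj₂ (bd a)

-- Layouts: paths on consecutive positions

-- A layout lists the numbers of vertices of paths placed one after the other on positions 0, 1, …;
-- `edge S p` says that positions p and p + 1 are joined.  A deleted vertex stays behind as a block of
-- length 1, and blocks of length 0 occupy no position.
edge : List ℕ → ℕ → Bool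
edge []          p       = false
edge (zero ∷ S)  p       = edge S p
edge (suc k ∷ S) zero    = 0 <ᵇ k
edge (suc k ∷ S) (suc p) = edge (k ∷ S) p

size : List ℕ → ℕ
size = sum

edgeCount : List ℕ → ℕ
edgeCount S = sum (map pred S)

Adj : (ℕ → Bool) → Rel
Adj L p q = (suc p ≡ q × L p ≡ true) ⊎ (suc q ≡ p × L q ≡ true)

dropVertex : (ℕ → Bool) → ℕ → ℕ → Bool
dropVertex L z w = L w ∧ not (w ≡ᵇ z) ∧ not (suc w ≡ᵇ z)

dropEdge : (ℕ → Bool) → ℕ → ℕ → Bool
dropEdge L r w = L w ∧ not (w ≡ᵇ r)

edge-shift : ∀ k S p → edge (k ∷ S) (k + p) ≡ edge S p
edge-shift zero    S p = refl
edge-shift (suc k) S p = edge-shift k S p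

edge-++ : ∀ P S p → edge (P ++ S) (p + size P) ≡ edge S p
edge-++ []      S p = cong (edge S) (ℕ.+-identityʳ p)
edge-++ (k ∷ P) S p = begin
  edge (k ∷ P ++ S) (p + (k + size P)) ≡⟨ cong (edge (k ∷ P ++ S)) (x∙yz≈y∙xz p k (size P)) ⟩
  edge (k ∷ P ++ S) (k + (p + size P)) ≡⟨ edge-shift k (P ++ S) (p + size P) ⟩
  edge (P ++ S) (p + size P)           ≡⟨ edge-++ P S p ⟩
  edge S p                             ∎
  where open ≡-Reasoning

edge-inner : ∀ k S i → suc i < k → edge (k ∷ S) i ≡ true
edge-inner (suc (suc k)) S zero    _          = refl
edge-inner (suc k)       S (suc i) (s≤s i<k)  = edge-inner k S i i<k

edge-++-inner : ∀ P k Q i → suc i < k → edge (P ++ k ∷ Q) (i + size P) ≡ true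
edge-++-inner P k Q i lt = trans (edge-++ P (k ∷ Q) i) (edge-inner k Q i lt)

edge-within : ∀ k S i → i < k → edge (k ∷ S) i ≡ true → suc i < k
edge-within (suc zero)    S zero    _         ()
edge-within (suc (suc k)) S zero    _         _ = s≤s (s≤s z≤n)
edge-within (suc k)       S (suc i) (s≤s i<k) h = s≤s (edge-within k S i i<k h)

edge-bound : ∀ S p → edge S p ≡ true → suc p < size S
edge-bound (zero ∷ S)          p       h = edge-bound S p h
edge-bound (suc (suc k) ∷ S)   zero    _ = s≤s (s≤s z≤n)
edge-bound (suc k ∷ S)         (suc p) h = s≤s (edge-bound (k ∷ S) p h)

edge-last : ∀ P S w → suc w ≡ size P → edge (P ++ S) w ≡ false
edge-last (zero ∷ P)        S w       e = edge-last P S w e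
edge-last (suc zero ∷ P)    S zero    _ = refl
edge-last (suc k ∷ P)       S (suc w) e = edge-last (k ∷ P) S w (ℕ.suc-injective e)

edge-delete : ∀ a b Q w → edge (a ∷ 1 ∷ b ∷ Q) w ≡ dropVertex (edge (a + suc b ∷ Q)) a w
edge-delete zero          b Q zero    = sym (Data.Bool.Properties.∧-zeroʳ _)
edge-delete zero          b Q (suc w) = sym (Data.Bool.Properties.∧-identityʳ _)
edge-delete (suc zero)    b Q zero    = refl
edge-delete (suc (suc a)) b Q zero    = refl
edge-delete (suc a)       b Q (suc w) = edge-delete a b Q w

edge-cut : ∀ a b Q w → edge (suc a ∷ b ∷ Q) w ≡ dropEdge (edge (suc a + b ∷ Q)) a w
edge-cut zero    b Q zero    = sym (Data.Bool.Properties.∧-zeroʳ _)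
edge-cut zero    b Q (suc w) = sym (Data.Bool.Properties.∧-identityʳ _)
edge-cut (suc a) b Q zero    = refl
edge-cut (suc a) b Q (suc w) = edge-cut a b Q w

dropVertex-++ : ∀ {S S′ z} → (∀ w → edge S′ w ≡ dropVertex (edge S) z w) →
                ∀ P w → edge (P ++ S′) w ≡ dropVertex (edge (P ++ S)) (z + size P) w
dropVertex-++ {z = z} h [] w rewrite ℕ.+-identityʳ z = h w
dropVertex-++ {S} {S′} {z} h (k ∷ P) w rewrite x∙yz≈y∙xz z k (size P) = go k w
  where
  go : ∀ k w → edge (k ∷ P ++ S′) w ≡ dropVertex (edge (k ∷ P ++ S)) (k + (z + size P)) w
  go zero          w       = dropVertex-++ h P w
  go (suc zero)    zero    = refl
  go (suc (suc k)) zero    = refl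
  go (suc k)       (suc w) = go k w

dropEdge-++ : ∀ {S S′ r} → (∀ w → edge S′ w ≡ dropEdge (edge S) r w) →
              ∀ P w → edge (P ++ S′) w ≡ dropEdge (edge (P ++ S)) (r + size P) w
dropEdge-++ {r = r} h [] w rewrite ℕ.+-identityʳ r = h w
dropEdge-++ {S} {S′} {r} h (k ∷ P) w rewrite x∙yz≈y∙xz r k (size P) = go k w
  where
  go : ∀ k w → edge (k ∷ P ++ S′) w ≡ dropEdge (edge (k ∷ P ++ S)) (k + (r + size P)) w
  go zero    w       = dropEdge-++ h P w
  go (suc k) zero    = sym (Data.Bool.Properties.∧-identityʳ _)
  go (suc k) (suc w) = go k w

size-++ : ∀ P Q → size (P ++ Q) ≡ size P + size Q
size-++ = Data.Nat.ListAction.Properties.sum-++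

edgeCount-++ : ∀ P Q → edgeCount (P ++ Q) ≡ edgeCount P + edgeCount Q
edgeCount-++ P Q = trans (cong sum (Data.List.Properties.map-++ pred P Q)) (size-++ (map pred P) (map pred Q))

size-replace : ∀ P X k Q → size X ≡ k → size (P ++ X ++ Q) ≡ size (P ++ k ∷ Q)
size-replace P X k Q e = begin
  size (P ++ X ++ Q)         ≡⟨ size-++ P (X ++ Q) ⟩
  size P + size (X ++ Q)     ≡⟨ cong (size P +_) (trans (size-++ X Q) (cong (_+ size Q) e)) ⟩
  size P + size (k ∷ Q)      ≡⟨ size-++ P (k ∷ Q) ⟨
  size (P ++ k ∷ Q)          ∎
  where open ≡-Reasoning

edgeCount-cut : ∀ P a b Q →
                edgeCount (P ++ (suc a + suc b) ∷ Q) ≡ suc (edgeCount (P ++ suc a ∷ suc b ∷ Q))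
edgeCount-cut P a b Q = begin
  edgeCount (P ++ (suc a + suc b) ∷ Q)         ≡⟨ edgeCount-++ P ((suc a + suc b) ∷ Q) ⟩
  edgeCount P + (a + suc b + edgeCount Q)      ≡⟨ cong (λ x → edgeCount P + (x + edgeCount Q)) (ℕ.+-suc a b) ⟩
  edgeCount P + suc (a + b + edgeCount Q)      ≡⟨ ℕ.+-suc (edgeCount P) _ ⟩
  suc (edgeCount P + (a + b + edgeCount Q))    ≡⟨ cong (λ x → suc (edgeCount P + x)) (ℕ.+-assoc a b _) ⟩
  suc (edgeCount P + (a + (b + edgeCount Q)))  ≡⟨ cong suc (edgeCount-++ P (suc a ∷ suc b ∷ Q)) ⟨
  suc (edgeCount (P ++ suc a ∷ suc b ∷ Q))     ∎
  where open ≡-Reasoning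

edgeCount-delete : ∀ P a b Q → edgeCount (P ++ a ∷ 1 ∷ b ∷ Q) ≤ edgeCount (P ++ (a + suc b) ∷ Q)
edgeCount-delete P a b Q = begin
  edgeCount (P ++ a ∷ 1 ∷ b ∷ Q)                  ≡⟨ edgeCount-++ P (a ∷ 1 ∷ b ∷ Q) ⟩
  edgeCount P + (pred a + (pred b + edgeCount Q)) ≤⟨ ℕ.+-monoʳ-≤ (edgeCount P)
                                                       (ℕ.+-mono-≤ (ℕ.pred[n]≤n {a}) (ℕ.+-monoˡ-≤ _ (ℕ.pred[n]≤n {b}))) ⟩
  edgeCount P + (a + (b + edgeCount Q))           ≡⟨ cong (edgeCount P +_) (ℕ.+-assoc a b _) ⟨
  edgeCount P + (a + b + edgeCount Q)             ≡⟨ cong (λ x → edgeCount P + (pred x + edgeCount Q)) (ℕ.+-suc a b) ⟨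
  edgeCount P + (pred (a + suc b) + edgeCount Q)  ≡⟨ edgeCount-++ P ((a + suc b) ∷ Q) ⟨
  edgeCount (P ++ (a + suc b) ∷ Q)                ∎
  where open ℕ.≤-Reasoning

dropVertex-≡true : ∀ {L z w} → dropVertex L z w ≡ true ⇔ (L w ≡ true × w ≢ z × suc w ≢ z)
dropVertex-≡true = mk⇔
  (λ h → let h₁ , h₂ = to ∧-≡true h ; h₃ , h₄ = to ∧-≡true h₂
         in h₁ , to not-≡ᵇ-≡true h₃ , to not-≡ᵇ-≡true h₄)
  (λ (h₁ , n₁ , n₂) → from ∧-≡true (h₁ , from ∧-≡true (from not-≡ᵇ-≡true n₁ , from not-≡ᵇ-≡true n₂)))

dropEdge-≡true : ∀ {L r w} → dropEdge L r w ≡ true ⇔ (L w ≡ true × w ≢ r)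
dropEdge-≡true = mk⇔
  (λ h → let h₁ , h₂ = to ∧-≡true h in h₁ , to not-≡ᵇ-≡true h₂)
  (λ (h₁ , n) → from ∧-≡true (h₁ , from not-≡ᵇ-≡true n))

n≢2+n : ∀ {n} → n ≢ suc (suc n)
n≢2+n e = ℕ.<-irrefl e (ℕ.<-trans (ℕ.n<1+n _) (ℕ.n<1+n _))

module _ {L L′ : ℕ → Bool} where

  Adj-dropVertex : ∀ {z} → (∀ w → L′ w ≡ dropVertex L z w) → ∀ p q → Adj L′ p q ⇔ (Adj L ─ᵛ z) p q
  Adj-dropVertex {z} eq p q = mk⇔ forth back
    where
    dv : ∀ w → L′ w ≡ true ⇔ (L w ≡ true × w ≢ z × suc w ≢ z)
    dv w = subst (λ b → b ≡ true ⇔ _) (sym (eq w)) (dropVertex-≡true {L})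
    forth : Adj L′ p q → (Adj L ─ᵛ z) p q
    forth (inj₁ (refl , h)) = let h₁ , n₁ , n₂ = to (dv p) h in inj₁ (refl , h₁) , n₁ , n₂
    forth (inj₂ (refl , h)) = let h₁ , n₁ , n₂ = to (dv q) h in inj₂ (refl , h₁) , n₂ , n₁
    back : (Adj L ─ᵛ z) p q → Adj L′ p q
    back (inj₁ (refl , h) , n₁ , n₂) = inj₁ (refl , from (dv p) (h , n₁ , n₂))
    back (inj₂ (refl , h) , n₁ , n₂) = inj₂ (refl , from (dv q) (h , n₂ , n₁))

  Adj-dropEdge : ∀ {r} → (∀ w → L′ w ≡ dropEdge L r w) →
                 ∀ p q → Adj L′ p q ⇔ (Adj L ─ᵉ (r , suc r)) p q
  Adj-dropEdge {r} eq p q = mk⇔ forth back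
    where
    de : ∀ w → L′ w ≡ true ⇔ (L w ≡ true × w ≢ r)
    de w = subst (λ b → b ≡ true ⇔ _) (sym (eq w)) (dropEdge-≡true {L})
    forth : Adj L′ p q → (Adj L ─ᵉ (r , suc r)) p q
    forth (inj₁ (refl , h)) = let h₁ , n = to (de p) h in inj₁ (refl , h₁) , λ
      { (inj₁ (e , _)) → n e ; (inj₂ (refl , e)) → n≢2+n (sym e) }
    forth (inj₂ (refl , h)) = let h₁ , n = to (de q) h in inj₂ (refl , h₁) , λ
      { (inj₁ (refl , e)) → n≢2+n e ; (inj₂ (_ , e)) → n e }
    back : (Adj L ─ᵉ (r , suc r)) p q → Adj L′ p q
    back (inj₁ (refl , h) , ¬s) = inj₁ (refl , from (de p) (h , λ { refl → ¬s (inj₁ (refl , refl)) }))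
    back (inj₂ (refl , h) , ¬s) = inj₂ (refl , from (de q) (h , λ { refl → ¬s (inj₂ (refl , refl)) }))

record Deletable (L : ℕ → Bool) (z : ℕ) : Set where
  field
    edge-at     : L z ≡ true
    edge-after  : L (suc z) ≡ true
    edge-before : ∀ w → suc w ≡ z → L w ≡ true → ∃[ w′ ] (suc w′ ≡ w × L w′ ≡ true)

deletable⇒leftAvail′ : ∀ {L z} → Deletable L z → LeftAvail′ (Adj L) z
deletable⇒leftAvail′ {L} {z} d = (suc z , inj₁ (refl , edge-at)) , other
  where
  open Deletable d
  other : ∀ q → Adj L z q → HasOtherNbr′ (Adj L) q z
  other q (inj₁ (refl , _)) = suc q , (λ e → n≢2+n (sym e)) , inj₁ (refl , edge-after)
  other q (inj₂ (refl , h)) with edge-before q refl h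
  ... | w′ , refl , h′ = w′ , n≢2+n , inj₂ (refl , h′)

ThreeEdgesFrom : (ℕ → Bool) → ℕ → Set
ThreeEdgesFrom L r = L r ≡ true × L (suc r) ≡ true × L (suc (suc r)) ≡ true

threeEdges⇒rightAvail′ : ∀ {L r} → ThreeEdgesFrom L r → RightAvail′ (Adj L) (suc r) (suc (suc r))
threeEdges⇒rightAvail′ (h₀ , h₁ , h₂) =
  inj₁ (refl , h₁) , (_ , n≢2+n , inj₂ (refl , h₀)) , (_ , (λ e → n≢2+n (sym e)) , inj₁ (refl , h₂))

oriented-threeEdges : ∀ {L p} → L p ≡ true → HasOtherNbr′ (Adj L) p (suc p) → HasOtherNbr′ (Adj L) (suc p) p →
                      ∃[ r ] (ThreeEdgesFrom L r × suc r ≡ p)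
oriented-threeEdges h (x , x≢ , inj₁ (e , _))  _                          = ⊥-elim (x≢ (sym e))
oriented-threeEdges h (x , _ , inj₂ (refl , hx)) (y , _ , inj₁ (refl , hy)) = x , (hx , h , hy) , refl
oriented-threeEdges h (x , _ , inj₂ (refl , _))  (y , y≢ , inj₂ (e , _))   = ⊥-elim (y≢ (ℕ.suc-injective e))

rightAvail′⇒threeEdges : ∀ {L p q} → RightAvail′ (Adj L) p q →
                         ∃[ r ] (ThreeEdgesFrom L r × SamePair (suc r) (suc (suc r)) p q)
rightAvail′⇒threeEdges (inj₁ (refl , h) , op , oq) with oriented-threeEdges h op oq
... | r , three , refl = r , three , inj₁ (refl , refl)
rightAvail′⇒threeEdges (inj₂ (refl , h) , op , oq) with oriented-threeEdges h oq op
... | r , three , refl = r , three , inj₂ (refl , refl)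

Adj-bounded : ∀ {S m} → size S ≤ m → Bounded m (Adj (edge S))
Adj-bounded {S} S≤m (inj₁ (refl , h)) =
  let q<m = ℕ.<-≤-trans (edge-bound S _ h) S≤m in ℕ.<-trans (ℕ.n<1+n _) q<m , q<m
Adj-bounded {S} S≤m (inj₂ (refl , h)) =
  let p<m = ℕ.<-≤-trans (edge-bound S _ h) S≤m in p<m , ℕ.<-trans (ℕ.n<1+n _) p<m

record Location (S : List ℕ) (p : ℕ) : Set where
  field
    before : List ℕ
    block  : ℕ
    after  : List ℕ
    offset : ℕ
    splits : S ≡ before ++ block ∷ after
    at     : p ≡ offset + size before
    inside : suc offset < block

locate : ∀ S p → edge S p ≡ true → Location S p
locate (k ∷ S) p h with p ℕ.<? k
... | yes p<k = record { before = [] ; block = k ; after = S ; offset = p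
                       ; splits = refl ; at = sym (ℕ.+-identityʳ p) ; inside = edge-within k S p p<k h }
... | no p≮k with ℕ.m≤n⇒∃[o]m+o≡n (ℕ.≮⇒≥ p≮k)
...   | j , refl = record
  { before = k ∷ before ; block = block ; after = after ; offset = offset
  ; splits = cong (k ∷_) splits ; at = trans (cong (k +_) at) (x∙yz≈y∙xz k offset (size before))
  ; inside = inside }
  where open Location (locate S j (trans (sym (edge-shift k S j)) h))

-- Profiles

-- How many paths of a layout have exactly 3, …, 8 and at least 9 vertices; shorter paths allow no move.
record Profile : Set where
  constructor ⟨_,_,_,_,_,_,_⟩
  field threes fours fives sixes sevens eights larges : ℕ
open Profile

data Class : Set where
  three four five six seven eight large : Class

_∈ᶜ_ : ℕ → Class → Bool
k ∈ᶜ three = k ≡ᵇ 3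
k ∈ᶜ four  = k ≡ᵇ 4
k ∈ᶜ five  = k ≡ᵇ 5
k ∈ᶜ six   = k ≡ᵇ 6
k ∈ᶜ seven = k ≡ᵇ 7
k ∈ᶜ eight = k ≡ᵇ 8
k ∈ᶜ large = 8 <ᵇ k

large⇒9≤ : ∀ {j} → (j ∈ᶜ large) ≡ true → 9 ≤ j
large⇒9≤ {j} e = ℕ.<ᵇ⇒< 8 j (Equivalence.from Data.Bool.Properties.T-≡ e)

count : Class → Profile → ℕ
count three = threes
count four  = fours
count five  = fives
count six   = sixes
count seven = sevens
count eight = eights
count large = larges

𝟙 : Bool → ℕ
𝟙 b = if b then 1 else 0

blockProfile : ℕ → Profile
blockProfile k = ⟨ 𝟙 (k ∈ᶜ three) , 𝟙 (k ∈ᶜ four) , 𝟙 (k ∈ᶜ five) , 𝟙 (k ∈ᶜ six)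
                 , 𝟙 (k ∈ᶜ seven) , 𝟙 (k ∈ᶜ eight) , 𝟙 (k ∈ᶜ large) ⟩

infixr 6 _⊕_
_⊕_ : Profile → Profile → Profile
p ⊕ q = ⟨ threes p + threes q , fours p + fours q , fives p + fives q , sixes p + sixes q
        , sevens p + sevens q , eights p + eights q , larges p + larges q ⟩

profile : List ℕ → Profile
profile []      = ⟨ 0 , 0 , 0 , 0 , 0 , 0 , 0 ⟩
profile (k ∷ S) = blockProfile k ⊕ profile S

profile-≡ : ∀ {p q} → threes p ≡ threes q → fours p ≡ fours q → fives p ≡ fives q → sixes p ≡ sixes q →
            sevens p ≡ sevens q → eights p ≡ eights q → larges p ≡ larges q → p ≡ q
profile-≡ refl refl refl refl refl refl refl = refl

⊕-swap : ∀ p q r → p ⊕ (q ⊕ r) ≡ q ⊕ (p ⊕ r)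
⊕-swap p q r =
  profile-≡ (swap threes) (swap fours) (swap fives) (swap sixes) (swap sevens) (swap eights) (swap larges)
  where
  swap : ∀ f → f p + (f q + f r) ≡ f q + (f p + f r)
  swap f = x∙yz≈y∙xz (f p) (f q) (f r)

profile-middle : ∀ P k Q → profile (P ++ k ∷ Q) ≡ blockProfile k ⊕ profile (P ++ Q)
profile-middle []      k Q = refl
profile-middle (j ∷ P) k Q =
  trans (cong (blockProfile j ⊕_) (profile-middle P k Q)) (⊕-swap (blockProfile j) (blockProfile k) _)

profile-cut : ∀ P a b Q → profile (P ++ a ∷ b ∷ Q) ≡ blockProfile a ⊕ blockProfile b ⊕ profile (P ++ Q)
profile-cut P a b Q = trans (profile-middle P a (b ∷ Q)) (cong (blockProfile a ⊕_) (profile-middle P b Q))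

profile-delete : ∀ P a b Q → profile (P ++ a ∷ 1 ∷ b ∷ Q) ≡ blockProfile a ⊕ blockProfile b ⊕ profile (P ++ Q)
profile-delete P a b Q = trans (profile-middle P a (1 ∷ b ∷ Q)) (cong (blockProfile a ⊕_) (profile-cut P 1 b Q))

count-∷ : ∀ c k S → count c (profile (k ∷ S)) ≡ 𝟙 (k ∈ᶜ c) + count c (profile S)
count-∷ three k S = refl
count-∷ four  k S = refl
count-∷ five  k S = refl
count-∷ six   k S = refl
count-∷ seven k S = refl
count-∷ eight k S = refl
count-∷ large k S = refl

find : ∀ c S → 1 ≤ count c (profile S) → ∃[ k ] (k ∈ S × (k ∈ᶜ c) ≡ true)
find three [] ()
find four  [] ()
find five  [] ()
find six   [] ()
find seven [] ()
find eight [] ()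
find large [] ()
find c (k ∷ S) h = go (k ∈ᶜ c) refl (subst (1 ≤_) (count-∷ c k S) h)
  where
  go : ∀ b → (k ∈ᶜ c) ≡ b → 1 ≤ 𝟙 b + count c (profile S) → ∃[ j ] (j ∈ k ∷ S × (j ∈ᶜ c) ≡ true)
  go true  e _ = k , here refl , e
  go false _ h with find c S h
  ... | j , j∈S , e = j , there j∈S , e

-- The exceptional profiles

-- Left, moving first (L) or second (R), wins every position whose profile is not listed here.
data LeftLosesL : Profile → Set where
  noLongPath : ∀ t → LeftLosesL ⟨ t , 0 , 0 , 0 , 0 , 0 , 0 ⟩
  twoFours   : LeftLosesL ⟨ 0 , 2 , 0 , 0 , 0 , 0 , 0 ⟩

data LeftLosesR : Profile → Set where
  oneFour    : ∀ t → LeftLosesR ⟨ t , 1 , 0 , 0 , 0 , 0 , 0 ⟩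
  oneFive    : ∀ t → LeftLosesR ⟨ t , 0 , 1 , 0 , 0 , 0 , 0 ⟩
  oneSix     : ∀ t → LeftLosesR ⟨ t , 0 , 0 , 1 , 0 , 0 , 0 ⟩
  oneEight   : LeftLosesR ⟨ 0 , 0 , 0 , 0 , 0 , 1 , 0 ⟩
  threeFours : LeftLosesR ⟨ 0 , 3 , 0 , 0 , 0 , 0 , 0 ⟩
  fourSix    : LeftLosesR ⟨ 0 , 1 , 0 , 1 , 0 , 0 , 0 ⟩

leftLosesR? : ∀ p → Dec (LeftLosesR p)
leftLosesR? ⟨ _ , _ , _ , _ , suc _ , _ , _ ⟩ = no λ ()
leftLosesR? ⟨ _ , _ , _ , _ , _ , _ , suc _ ⟩ = no λ ()
leftLosesR? ⟨ _ , _ , _ , _ , 0 , suc (suc _) , 0 ⟩ = no λ ()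
leftLosesR? ⟨ 0 , 0 , 0 , 0 , 0 , 1 , 0 ⟩ = yes oneEight
leftLosesR? ⟨ suc _ , _ , _ , _ , 0 , 1 , 0 ⟩ = no λ ()
leftLosesR? ⟨ _ , suc _ , _ , _ , 0 , 1 , 0 ⟩ = no λ ()
leftLosesR? ⟨ _ , _ , suc _ , _ , 0 , 1 , 0 ⟩ = no λ ()
leftLosesR? ⟨ _ , _ , _ , suc _ , 0 , 1 , 0 ⟩ = no λ ()
leftLosesR? ⟨ _ , _ , suc _ , suc _ , 0 , 0 , 0 ⟩ = no λ ()
leftLosesR? ⟨ _ , _ , suc (suc _) , _ , 0 , 0 , 0 ⟩ = no λ ()
leftLosesR? ⟨ _ , _ , _ , suc (suc _) , 0 , 0 , 0 ⟩ = no λ ()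
leftLosesR? ⟨ _ , suc _ , suc _ , _ , 0 , 0 , 0 ⟩ = no λ ()
leftLosesR? ⟨ t , 0 , 1 , 0 , 0 , 0 , 0 ⟩ = yes (oneFive t)
leftLosesR? ⟨ t , 0 , 0 , 1 , 0 , 0 , 0 ⟩ = yes (oneSix t)
leftLosesR? ⟨ _ , 0 , 0 , 0 , 0 , 0 , 0 ⟩ = no λ ()
leftLosesR? ⟨ t , 1 , 0 , 0 , 0 , 0 , 0 ⟩ = yes (oneFour t)
leftLosesR? ⟨ 0 , 1 , 0 , 1 , 0 , 0 , 0 ⟩ = yes fourSix
leftLosesR? ⟨ suc _ , 1 , 0 , 1 , 0 , 0 , 0 ⟩ = no λ ()
leftLosesR? ⟨ _ , suc (suc _) , 0 , 1 , 0 , 0 , 0 ⟩ = no λ ()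
leftLosesR? ⟨ _ , 2 , 0 , 0 , 0 , 0 , 0 ⟩ = no λ ()
leftLosesR? ⟨ 0 , 3 , 0 , 0 , 0 , 0 , 0 ⟩ = yes threeFours
leftLosesR? ⟨ suc _ , 3 , 0 , 0 , 0 , 0 , 0 ⟩ = no λ ()
leftLosesR? ⟨ _ , suc (suc (suc (suc _))) , 0 , 0 , 0 , 0 , 0 ⟩ = no λ ()

longPath-¬leftLosesL : ∀ n p → ¬ LeftLosesL (blockProfile (5 + n) ⊕ p)
longPath-¬leftLosesL 0 ⟨ _ , _ , _ , _ , _ , _ , _ ⟩ ()
longPath-¬leftLosesL 1 ⟨ _ , _ , _ , _ , _ , _ , _ ⟩ ()
longPath-¬leftLosesL 2 ⟨ _ , _ , _ , _ , _ , _ , _ ⟩ ()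
longPath-¬leftLosesL 3 ⟨ _ , _ , _ , _ , _ , _ , _ ⟩ ()
longPath-¬leftLosesL (suc (suc (suc (suc n)))) ⟨ _ , _ , _ , _ , _ , _ , _ ⟩ ()

cut-leftLosesL⇒leftLosesR : ∀ a b p → 2 ≤ a → 2 ≤ b →
                            LeftLosesL (blockProfile a ⊕ blockProfile b ⊕ p) → LeftLosesR (blockProfile (a + b) ⊕ p)
cut-leftLosesL⇒leftLosesR 0 _ _ () _
cut-leftLosesL⇒leftLosesR 1 _ _ (s≤s ()) _
cut-leftLosesL⇒leftLosesR _ 0 _ _ ()
cut-leftLosesL⇒leftLosesR _ 1 _ _ (s≤s ())
cut-leftLosesL⇒leftLosesR (suc (suc (suc (suc (suc a))))) b p _ _ lost = ⊥-elim (longPath-¬leftLosesL a _ lost)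
cut-leftLosesL⇒leftLosesR a (suc (suc (suc (suc (suc b))))) p _ _ lost =
  ⊥-elim (longPath-¬leftLosesL b _ (subst LeftLosesL (⊕-swap (blockProfile a) _ p) lost))
cut-leftLosesL⇒leftLosesR 2 2 ⟨ _ , _ , _ , _ , _ , _ , _ ⟩ _ _ (noLongPath t) = oneFour t
cut-leftLosesL⇒leftLosesR 2 2 ⟨ _ , _ , _ , _ , _ , _ , _ ⟩ _ _ twoFours       = threeFours
cut-leftLosesL⇒leftLosesR 2 3 ⟨ _ , _ , _ , _ , _ , _ , _ ⟩ _ _ (noLongPath (suc t)) = oneFive t
cut-leftLosesL⇒leftLosesR 3 2 ⟨ _ , _ , _ , _ , _ , _ , _ ⟩ _ _ (noLongPath (suc t)) = oneFive t
cut-leftLosesL⇒leftLosesR 3 3 ⟨ _ , _ , _ , _ , _ , _ , _ ⟩ _ _ (noLongPath (suc (suc t))) = oneSix t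
cut-leftLosesL⇒leftLosesR 2 4 ⟨ _ , _ , _ , _ , _ , _ , _ ⟩ _ _ twoFours = fourSix
cut-leftLosesL⇒leftLosesR 4 2 ⟨ _ , _ , _ , _ , _ , _ , _ ⟩ _ _ twoFours = fourSix
cut-leftLosesL⇒leftLosesR 3 4 ⟨ _ , _ , _ , _ , _ , _ , _ ⟩ _ _ ()
cut-leftLosesL⇒leftLosesR 4 3 ⟨ _ , _ , _ , _ , _ , _ , _ ⟩ _ _ ()
cut-leftLosesL⇒leftLosesR 4 4 ⟨ _ , _ , _ , _ , _ , _ , _ ⟩ _ _ twoFours = oneEight

atLeast4 : ∀ d {j} → (j ≡ᵇ 4 + d) ≡ true → 4 ≤ j
atLeast4 d e = subst (4 ≤_) (sym (to ≡ᵇ-≡true e)) (ℕ.m≤m+n 4 d)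

¬leftLosesL⇒longClass : ∀ p → ¬ LeftLosesL p → ∃[ c ] (1 ≤ count c p × ∀ {j} → (j ∈ᶜ c) ≡ true → 4 ≤ j)
¬leftLosesL⇒longClass ⟨ _ , _ , _ , _ , _ , _ , suc _ ⟩ _ =
  large , s≤s z≤n , λ {j} e → ℕ.≤-trans (ℕ.m≤m+n 4 5) (large⇒9≤ {j} e)
¬leftLosesL⇒longClass ⟨ _ , _ , _ , _ , _ , suc _ , _ ⟩ _ = eight , s≤s z≤n , atLeast4 4
¬leftLosesL⇒longClass ⟨ _ , _ , _ , _ , suc _ , 0 , 0 ⟩ _ = seven , s≤s z≤n , atLeast4 3
¬leftLosesL⇒longClass ⟨ _ , _ , _ , suc _ , 0 , 0 , 0 ⟩ _ = six   , s≤s z≤n , atLeast4 2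
¬leftLosesL⇒longClass ⟨ _ , _ , suc _ , 0 , 0 , 0 , 0 ⟩ _ = five  , s≤s z≤n , atLeast4 1
¬leftLosesL⇒longClass ⟨ _ , suc _ , 0 , 0 , 0 , 0 , 0 ⟩ _ = four  , s≤s z≤n , atLeast4 0
¬leftLosesL⇒longClass ⟨ t , 0 , 0 , 0 , 0 , 0 , 0 ⟩ safe = ⊥-elim (safe (noLongPath t))

¬leftLosesL⇒threeEdges : ∀ S → ¬ LeftLosesL (profile S) → ∃[ r ] ThreeEdgesFrom (edge S) r
¬leftLosesL⇒threeEdges S safe with ¬leftLosesL⇒longClass (profile S) safe
... | c , present , long with find c S present
...   | k , k∈S , k∈c with ∈-∃++ k∈S | long k∈c
...     | P , Q , refl | 4≤k =
  size P , edge-++-inner P k Q 0 (ℕ.≤-trans (ℕ.m≤m+n 2 2) 4≤k)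
         , edge-++-inner P k Q 1 (ℕ.≤-trans (ℕ.m≤m+n 3 1) 4≤k)
         , edge-++-inner P k Q 2 4≤k

-- Right's moves

record RightMove (S : List ℕ) (c : ℕ) : Set where
  field
    result     : List ℕ
    drops      : ∀ w → edge result w ≡ dropEdge (edge S) c w
    size≡      : size result ≡ size S
    edgeCount≡ : edgeCount S ≡ suc (edgeCount result)
    keeps      : ¬ LeftLosesR (profile S) → ¬ LeftLosesL (profile result)

cutBlock : ∀ P a b Q → RightMove (P ++ (suc (suc a) + suc (suc b)) ∷ Q) (suc a + size P)
cutBlock P a b Q = record
  { result     = P ++ A ∷ B ∷ Q
  ; drops      = dropEdge-++ (edge-cut (suc a) B Q) P
  ; size≡      = size-replace P (A ∷ B ∷ []) (A + B) Q (cong (A +_) (ℕ.+-identityʳ B))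
  ; edgeCount≡ = edgeCount-cut P (suc a) (suc b) Q
  ; keeps      = λ safe lost → safe (subst LeftLosesR (sym (profile-middle P (A + B) Q))
                   (cut-leftLosesL⇒leftLosesR A B (profile (P ++ Q)) (s≤s (s≤s z≤n)) (s≤s (s≤s z≤n))
                     (subst LeftLosesL (profile-cut P A B Q) lost)))
  }
  where
  A = suc (suc a)
  B = suc (suc b)

longBlock-split : ∀ k Q i → suc i < k → edge (k ∷ Q) (suc i) ≡ true → edge (k ∷ Q) (suc (suc i)) ≡ true →
                  ∃[ o ] (k ≡ suc (suc i) + suc (suc o))
longBlock-split k Q i in₁ h₁ h₂
  with ℕ.m≤n⇒∃[o]m+o≡n (edge-within k Q (suc (suc i)) (edge-within k Q (suc i) in₁ h₁) h₂)
... | o , refl = o , cong (suc ∘ suc) (sym (trans (ℕ.+-suc i (suc o)) (cong suc (ℕ.+-suc i o))))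

rightMove : ∀ S r → ThreeEdgesFrom (edge S) r → RightMove S (suc r)
rightMove S r (h₀ , h₁ , h₂) with locate S r h₀
... | record { before = P ; block = k ; after = Q ; offset = i ; splits = refl ; at = refl ; inside = in₁ }
  with longBlock-split k Q i in₁ (trans (sym (edge-++ P (k ∷ Q) _)) h₁) (trans (sym (edge-++ P (k ∷ Q) _)) h₂)
... | o , refl = cutBlock P i o Q

-- Left's replies

record WinningLeftMove (S : List ℕ) : Set where
  field
    result     : List ℕ
    deleted    : ℕ
    deletable  : Deletable (edge S) deleted
    drops      : ∀ w → edge result w ≡ dropVertex (edge S) deleted w
    size≡      : size result ≡ size S
    edgeCount≤ : edgeCount result ≤ edgeCount S
    safe       : ¬ LeftLosesR (profile result)

-- Left deletes the vertex with `front` vertices before it and `back` after it in a path of k vertices;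
-- the side conditions say that no neighbour of that vertex becomes isolated.
record Reply (k : ℕ) (rest : Profile) : Set where
  constructor reply
  field
    front back : ℕ
    splits     : k ≡ front + suc back
    front-ok   : front ≡ 0 ⊎ 2 ≤ front
    back-ok    : 2 ≤ back
    safe       : ¬ LeftLosesR (blockProfile front ⊕ blockProfile back ⊕ rest)

endReply : ∀ {b rest} → ¬ LeftLosesR (blockProfile (2 + b) ⊕ rest) → Reply (3 + b) rest
endReply safe = reply 0 _ refl (inj₁ refl) (s≤s (s≤s z≤n)) safe

innerReply : ∀ a b {rest} → ¬ LeftLosesR (blockProfile (2 + a) ⊕ blockProfile (2 + b) ⊕ rest) →
             Reply (2 + a + suc (2 + b)) rest
innerReply a b safe = reply (2 + a) (2 + b) refl (inj₂ (s≤s (s≤s z≤n))) (s≤s (s≤s z≤n)) safe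

deletable-at : ∀ P a b Q → a ≡ 0 ⊎ 2 ≤ a → Deletable (edge (P ++ (a + suc (suc (suc b))) ∷ Q)) (a + size P)
deletable-at P a b Q front-ok = record
  { edge-at     = edge-++-inner P k Q a (near-front a (ℕ.n≤1+n a))
  ; edge-after  = edge-++-inner P k Q (suc a) (near-front (suc a) ℕ.≤-refl)
  ; edge-before = before front-ok }
  where
  k = a + suc (suc (suc b))
  near-front : ∀ j → j ≤ suc a → suc j < k
  near-front j j≤ = ℕ.≤-trans (s≤s (s≤s j≤)) (ℕ.≤-trans (s≤s (s≤s (s≤s (ℕ.m≤m+n a b))))
    (ℕ.≤-reflexive (sym (trans (ℕ.+-suc a _) (cong suc (trans (ℕ.+-suc a _) (cong suc (ℕ.+-suc a b))))))))
  before : a ≡ 0 ⊎ 2 ≤ a → ∀ w → suc w ≡ a + size P → edge (P ++ k ∷ Q) w ≡ true →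
           ∃[ w′ ] (suc w′ ≡ w × edge (P ++ k ∷ Q) w′ ≡ true)
  before (inj₁ refl) w e h = ⊥-elim (true≢false (trans (sym h) (edge-last P (k ∷ Q) w e)))
  before (inj₂ (s≤s (s≤s {n = a′} _))) w refl h =
    a′ + size P , refl , edge-++-inner P k Q a′ (near-front a′ (ℕ.m≤n+m a′ 3))

deleteAt : ∀ P k Q → Reply k (profile (P ++ Q)) → WinningLeftMove (P ++ k ∷ Q)
deleteAt P _ Q (reply _ 0 _ _ () _)
deleteAt P _ Q (reply _ 1 _ _ (s≤s ()) _)
deleteAt P _ Q (reply a (suc (suc b)) refl front-ok _ safe) = record
  { result     = P ++ a ∷ 1 ∷ suc (suc b) ∷ Q
  ; deleted    = a + size P
  ; deletable  = deletable-at P a b Q front-ok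
  ; drops      = dropVertex-++ (edge-delete a (suc (suc b)) Q) P
  ; size≡      = size-replace P (a ∷ 1 ∷ suc (suc b) ∷ []) _ Q (cong (λ x → a + suc x) (ℕ.+-identityʳ _))
  ; edgeCount≤ = edgeCount-delete P a (suc (suc b)) Q
  ; safe       = λ lost → safe (subst LeftLosesR (profile-delete P a (suc (suc b)) Q) lost)
  }

leftMoveIn : ∀ {S p} → profile S ≡ p → ∀ k → k ∈ S →
             (∀ {rest} → p ≡ blockProfile k ⊕ rest → Reply k rest) → WinningLeftMove S
leftMoveIn eq k k∈S choose with ∈-∃++ k∈S
... | P , Q , refl = deleteAt P k Q (choose (trans (sym eq) (profile-middle P k Q)))

exactMember : ∀ {S p} c k → profile S ≡ p → .{{NonZero (count c p)}} →
              (∀ {j} → (j ∈ᶜ c) ≡ true → j ≡ k) → k ∈ S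
exactMember {S} c k eq only with find c S (subst (λ p → 1 ≤ count c p) (sym eq) (>-nonZero⁻¹ _))
... | j , j∈S , j∈c = subst (_∈ S) (only j∈c) j∈S

exact : ∀ {j k} → (j ≡ᵇ k) ≡ true → j ≡ k
exact = to ≡ᵇ-≡true

replyIn : ∀ {S p} c k → profile S ≡ p → .{{NonZero (count c p)}} →
          (∀ {j} → (j ∈ᶜ c) ≡ true → j ≡ k) →
          (∀ {rest} → p ≡ blockProfile k ⊕ rest → Reply k rest) → WinningLeftMove S
replyIn c k eq only = leftMoveIn eq k (exactMember c k eq only)

largeMember : ∀ {S p} → profile S ≡ p → .{{NonZero (larges p)}} → ∃[ n ] (9 + n ∈ S)
largeMember {S} eq with find large S (subst (λ p → 1 ≤ larges p) (sym eq) (>-nonZero⁻¹ _))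
... | j , j∈S , j∈c with ℕ.m≤n⇒∃[o]m+o≡n (large⇒9≤ {j} j∈c)
...   | n , refl = n , j∈S

largeReply : ∀ {t f₄ f₅ f₆ f₇ f₈ fₗ} n {rest} →
             ⟨ t , f₄ , f₅ , f₆ , f₇ , f₈ , suc fₗ ⟩ ≡ blockProfile (9 + n) ⊕ rest → Reply (9 + n) rest
largeReply (suc n) refl = endReply λ ()
largeReply {t} {f₄} {f₅} {f₆} {f₇} {f₈} {fₗ} zero refl
  with leftLosesR? ⟨ t , f₄ , f₅ , f₆ , f₇ , suc f₈ , fₗ ⟩
... | no ok       = endReply ok
... | yes oneEight = innerReply 2 2 λ ()

-- Left deletes an end vertex of a longest path.  When the decision says this hands Right a winning
-- profile, the witness pins the profile down and a different deletion is used.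
strategyFor : ∀ {S} p → profile S ≡ p → ¬ LeftLosesL p → WinningLeftMove S
strategyFor ⟨ t , f₄ , f₅ , f₆ , f₇ , f₈ , suc fₗ ⟩ eq _ with largeMember eq
... | n , n∈S = leftMoveIn eq (9 + n) n∈S (largeReply n)
strategyFor ⟨ t , f₄ , f₅ , f₆ , f₇ , suc f₈ , 0 ⟩ eq _ =
  replyIn eight 8 eq exact λ { refl → endReply λ () }
strategyFor ⟨ t , f₄ , f₅ , f₆ , suc f₇ , 0 , 0 ⟩ eq _ with leftLosesR? ⟨ t , f₄ , f₅ , suc f₆ , f₇ , 0 , 0 ⟩
... | no ok          = replyIn seven 7 eq exact λ { refl → endReply ok }
... | yes (oneSix _) = replyIn seven 7 eq exact λ { refl → innerReply 1 1 λ () }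
... | yes fourSix    = replyIn four 4 eq exact λ { refl → endReply λ () }
strategyFor ⟨ t , f₄ , f₅ , suc f₆ , 0 , 0 , 0 ⟩ eq _ with leftLosesR? ⟨ t , f₄ , suc f₅ , f₆ , 0 , 0 , 0 ⟩
... | no ok           = replyIn six 6 eq exact λ { refl → endReply ok }
... | yes (oneFive _) = replyIn six 6 eq exact λ { refl → innerReply 0 1 λ () }
strategyFor ⟨ t , f₄ , suc f₅ , 0 , 0 , 0 , 0 ⟩ eq _ with leftLosesR? ⟨ t , suc f₄ , f₅ , 0 , 0 , 0 , 0 ⟩
... | no ok           = replyIn five 5 eq exact λ { refl → endReply ok }
... | yes (oneFour _) = replyIn five 5 eq exact λ { refl → innerReply 0 0 λ () }
... | yes threeFours  = replyIn four 4 eq exact λ { refl → endReply λ () }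
strategyFor ⟨ t , suc f₄ , 0 , 0 , 0 , 0 , 0 ⟩ eq safe with leftLosesR? ⟨ suc t , f₄ , 0 , 0 , 0 , 0 , 0 ⟩
... | no ok = replyIn four 4 eq exact λ { refl → endReply ok }
strategyFor ⟨ suc t , 2 , 0 , 0 , 0 , 0 , 0 ⟩ eq _ | yes (oneFour _) =
  replyIn three 3 eq exact λ { refl → endReply λ () }
strategyFor ⟨ 0 , 2 , 0 , 0 , 0 , 0 , 0 ⟩ eq safe | yes (oneFour _) = ⊥-elim (safe twoFours)
strategyFor ⟨ t , 0 , 0 , 0 , 0 , 0 , 0 ⟩ eq safe = ⊥-elim (safe (noLongPath t))

leftStrategy : ∀ S → ¬ LeftLosesL (profile S) → WinningLeftMove S
leftStrategy S = strategyFor (profile S) refl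

module _ {m} (F : Frame m) where
  open Frame F

  record Models (S : List ℕ) (G : Pos m) : Set where
    field
      wellFormed : WellFormed G
      represents : Represents F (Adj (edge S)) G
      fits       : size S ≤ m

  module _ {S G} (M : Models S G) where
    open Models M

    models-rightHasMove : ¬ LeftLosesL (profile S) → RightHasMove G
    models-rightHasMove safe =
      rightHasMove F represents (Adj-bounded {S} fits)
        (threeEdges⇒rightAvail′ {edge S} (proj₂ (¬leftLosesL⇒threeEdges S safe)))

    models-delV : ∀ {S′ z} → Deletable (edge S) z → (∀ w → edge S′ w ≡ dropVertex (edge S) z w) →
                  size S′ ≡ size S → LeftAvail G (vertex z) × Models S′ (delV G (vertex z))
    models-delV {S′} {z} deletable drops size≡ =
      leftAvail F wellFormed represents bounded (vertex z)
        (subst (LeftAvail′ (Adj (edge S))) (sym at-z) (deletable⇒leftAvail′ {edge S} deletable))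
      , record
        { wellFormed = wellFormed-delV (vertex z) wellFormed
        ; represents = represents-cong F (λ x y → ⇔-sym (Adj-dropVertex {edge S} {edge S′} drops _ _))
                         (subst (λ i → Represents F (Adj (edge S) ─ᵛ i) (delV G (vertex z))) at-z
                           (represents-delV F (vertex z) represents))
        ; fits       = subst (_≤ m) (sym size≡) fits }
      where
      bounded = Adj-bounded {S} fits
      at-z : index (vertex z) ≡ z
      at-z = index-vertex (proj₁ (bounded (inj₁ (refl , Deletable.edge-at deletable))))

    models-delE : ∀ {S′ r u v} → SamePair (suc r) (suc (suc r)) (index u) (index v) →
                  (∀ w → edge S′ w ≡ dropEdge (edge S) (suc r) w) → size S′ ≡ size S → Models S′ (delE G u v)
    models-delE {S′} {r} {u} {v} pair drops size≡ = record
      { wellFormed = wellFormed-delE u v wellFormed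
      ; represents = represents-cong F
                       (λ x y → ⇔-trans (─ᵉ-cong {Adj (edge S)} pair _ _)
                                        (⇔-sym (Adj-dropEdge {edge S} {edge S′} drops _ _)))
                       (represents-delE F u v represents)
      ; fits       = subst (_≤ m) (sym size≡) fits }

  leftWinsL : ∀ n S {G} → Models S G → edgeCount S ≤ n → ¬ LeftLosesL (profile S) → LeftWinsL G
  leftWinsR : ∀ n S {G} → Models S G → edgeCount S ≤ n → ¬ LeftLosesR (profile S) → LeftWinsR G

  leftWinsL n S M ≤n safe =
    leftMove (models-rightHasMove M safe) (vertex deleted) (proj₁ next)
             (leftWinsR n result (proj₂ next) (ℕ.≤-trans edgeCount≤ ≤n) safe′)
    where
    open WinningLeftMove (leftStrategy S safe) renaming (safe to safe′)
    next = models-delV M deletable drops size≡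

  leftWinsR n S {G} M ≤n safe = allRight answer
    where
    answer : ∀ u v → RightAvail G u v → LeftWinsL (delE G u v)
    answer u v avail with rightAvail′⇒threeEdges (rightAvail′ F {Adj (edge S)} (Models.represents M) avail)
    ... | r , run , pair = continue n ≤n
      where
      open RightMove (rightMove S r run)
      continue : ∀ n → edgeCount S ≤ n → LeftWinsL (delE G u v)
      continue zero    ≤0 with subst (_≤ 0) edgeCount≡ ≤0
      ... | ()
      continue (suc n) ≤n = leftWinsL n result (models-delE M pair drops size≡)
                                      (ℕ.≤-pred (subst (_≤ suc n) edgeCount≡ ≤n)) (keeps safe)

-- The cycle

module Cycle (k : ℕ) where

  N n : ℕ
  N = 2 + k
  n = suc N

  path : List ℕ
  path = n ∷ []

  Cyc : Rel
  Cyc p q = Adj (edge path) p q ⊎ SamePair N 0 p q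

  SucMod : ℕ → ℕ → Set
  SucMod p q = suc p % n ≡ q

  path-edge : ∀ {p} → edge path p ≡ true ⇔ suc p < n
  path-edge {p} = mk⇔ (λ h → subst (suc p <_) (ℕ.+-identityʳ n) (edge-bound path p h)) (edge-inner n [] p)

  Adj-path : ∀ {p q} → p < n → q < n → Adj (edge path) p q ⇔ (suc p ≡ q ⊎ suc q ≡ p)
  Adj-path p<n q<n = mk⇔ (Data.Sum.map proj₁ proj₁)
    λ { (inj₁ refl) → inj₁ (refl , from path-edge q<n) ; (inj₂ refl) → inj₂ (refl , from path-edge p<n) }

  sucMod⇔ : ∀ {p q} → p < n → q < n → SucMod p q ⇔ (suc p ≡ q ⊎ (p ≡ N × q ≡ 0))
  sucMod⇔ {p} {q} p<n q<n = mk⇔ forth back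
    where
    forth : SucMod p q → suc p ≡ q ⊎ (p ≡ N × q ≡ 0)
    forth e with ℕ.m≤n⇒m<n∨m≡n p<n
    ... | inj₁ 1+p<n  = inj₁ (trans (sym (m<n⇒m%n≡m 1+p<n)) e)
    ... | inj₂ refl   = inj₂ (refl , trans (sym e) (n%n≡0 n))
    back : suc p ≡ q ⊎ (p ≡ N × q ≡ 0) → SucMod p q
    back (inj₁ refl)         = m<n⇒m%n≡m q<n
    back (inj₂ (p≡N , q≡0)) rewrite p≡N | q≡0 = n%n≡0 n

  Cyc⇔sucMod : ∀ {p q} → p < n → q < n → Cyc p q ⇔ (SucMod p q ⊎ SucMod q p)
  Cyc⇔sucMod {p} {q} p<n q<n = mk⇔ forth back
    where
    forth : Cyc p q → SucMod p q ⊎ SucMod q p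
    forth (inj₁ adj) with to (Adj-path p<n q<n) adj
    ... | inj₁ e = inj₁ (from (sucMod⇔ p<n q<n) (inj₁ e))
    ... | inj₂ e = inj₂ (from (sucMod⇔ q<n p<n) (inj₁ e))
    forth (inj₂ (inj₁ e)) = inj₁ (from (sucMod⇔ p<n q<n) (inj₂ e))
    forth (inj₂ (inj₂ (e₁ , e₂))) = inj₂ (from (sucMod⇔ q<n p<n) (inj₂ (e₂ , e₁)))
    back : SucMod p q ⊎ SucMod q p → Cyc p q
    back (inj₁ s) with to (sucMod⇔ p<n q<n) s
    ... | inj₁ e = inj₁ (from (Adj-path p<n q<n) (inj₁ e))
    ... | inj₂ e = inj₂ (inj₁ e)
    back (inj₂ s) with to (sucMod⇔ q<n p<n) s
    ... | inj₁ e = inj₁ (from (Adj-path p<n q<n) (inj₂ e))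
    ... | inj₂ (e₁ , e₂) = inj₂ (inj₂ (e₂ , e₁))

  cycAdj-≡true : ∀ {p q} → cycAdj n p q ≡ true ⇔
                 (suc p ≡ q ⊎ suc q ≡ p ⊎ (p ≡ 0 × suc q ≡ n) ⊎ (q ≡ 0 × suc p ≡ n))
  cycAdj-≡true = ⇔-trans ∨-≡true (≡ᵇ-≡true ⊎-⇔ ⇔-trans ∨-≡true (≡ᵇ-≡true ⊎-⇔ ⇔-trans ∨-≡true
                   (⇔-trans ∧-≡true (≡ᵇ-≡true ×-⇔ ≡ᵇ-≡true) ⊎-⇔ ⇔-trans ∧-≡true (≡ᵇ-≡true ×-⇔ ≡ᵇ-≡true))))

  cycAdj⇔Cyc : ∀ {p q} → p < n → q < n → cycAdj n p q ≡ true ⇔ Cyc p q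
  cycAdj⇔Cyc p<n q<n = ⇔-trans cycAdj-≡true (mk⇔
    (λ { (inj₁ e) → inj₁ (from (Adj-path p<n q<n) (inj₁ e))
       ; (inj₂ (inj₁ e)) → inj₁ (from (Adj-path p<n q<n) (inj₂ e))
       ; (inj₂ (inj₂ (inj₁ (e₁ , e₂)))) → inj₂ (inj₂ (e₁ , ℕ.suc-injective e₂))
       ; (inj₂ (inj₂ (inj₂ (e₁ , e₂)))) → inj₂ (inj₁ (ℕ.suc-injective e₂ , e₁)) })
    (λ { (inj₁ adj) → Data.Sum.map₂ inj₁ (to (Adj-path p<n q<n) adj)
       ; (inj₂ (inj₁ (refl , refl))) → inj₂ (inj₂ (inj₂ (refl , refl)))
       ; (inj₂ (inj₂ (refl , refl))) → inj₂ (inj₂ (inj₁ (refl , refl))) }))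

  mod-+ˡ : ∀ a b → (a % n + b) % n ≡ (a + b) % n
  mod-+ˡ a b = begin
    (a % n + b) % n             ≡⟨ %-distribˡ-+ (a % n) b n ⟩
    (a % n % n + b % n) % n     ≡⟨ cong (λ x → (x + b % n) % n) (m%n%n≡m%n a n) ⟩
    (a % n + b % n) % n         ≡⟨ %-distribˡ-+ a b n ⟨
    (a + b) % n                 ∎
    where open ≡-Reasoning

  sucMod-shift : ∀ d {a b} → SucMod a b → SucMod ((a + d) % n) ((b + d) % n)
  sucMod-shift d {a} refl = begin
    suc ((a + d) % n) % n       ≡⟨ cong (_% n) (ℕ.+-comm 1 ((a + d) % n)) ⟩
    ((a + d) % n + 1) % n       ≡⟨ mod-+ˡ (a + d) 1 ⟩
    (a + d + 1) % n             ≡⟨ cong (_% n) (ℕ.+-comm (a + d) 1) ⟩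
    (suc a + d) % n             ≡⟨ mod-+ˡ (suc a) d ⟨
    (suc a % n + d) % n         ∎
    where open ≡-Reasoning

  unshift : ∀ {d e} → d + e ≡ n → ∀ {a} → a < n → ((a + d) % n + e) % n ≡ a
  unshift {d} {e} d+e≡n {a} a<n = begin
    ((a + d) % n + e) % n       ≡⟨ mod-+ˡ (a + d) e ⟩
    (a + d + e) % n             ≡⟨ cong (_% n) (trans (ℕ.+-assoc a d e) (cong (a +_) d+e≡n)) ⟩
    (a + n) % n                 ≡⟨ [m+n]%n≡m%n a n ⟩
    a % n                       ≡⟨ m<n⇒m%n≡m a<n ⟩
    a                           ∎
    where open ≡-Reasoning

  rotation : ∀ s → s ≤ n → Frame n
  rotation s s≤n = record
    { index        = λ x → (toℕ x + (n ∸ s)) % n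
    ; vertex       = λ p → fromℕ< (m%n<n (p + s) n)
    ; vertex-index = λ x → toℕ-injective (trans (toℕ-fromℕ< _) (unshift {n ∸ s} {s} (ℕ.m∸n+n≡m s≤n) (toℕ<n x)))
    ; index-vertex = λ {p} p<n → trans (cong (λ x → (x + (n ∸ s)) % n) (toℕ-fromℕ< (m%n<n (p + s) n)))
                                       (unshift {s} {n ∸ s} (ℕ.m+[n∸m]≡n s≤n) p<n)
    }

  cycle-represented : ∀ s (s≤n : s ≤ n) → Represents (rotation s s≤n) Cyc (C n)
  cycle-represented s s≤n = mkRepresents λ x y →
    ⇔-trans (cycAdj⇔Cyc (toℕ<n x) (toℕ<n y)) (⇔-trans (Cyc⇔sucMod (toℕ<n x) (toℕ<n y))
      (⇔-trans (mk⇔ rotate unrotate) (⇔-sym (Cyc⇔sucMod (index<n x) (index<n y)))))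
    where
    open Frame (rotation s s≤n)
    index<n : ∀ x → index x < n
    index<n x = m%n<n (toℕ x + (n ∸ s)) n
    forward : ∀ x y → SucMod (toℕ x) (toℕ y) → SucMod (index x) (index y)
    forward x y = sucMod-shift (n ∸ s) {toℕ x} {toℕ y}
    back : ∀ x y → SucMod (index x) (index y) → SucMod (toℕ x) (toℕ y)
    back x y h = subst₂ SucMod (unshift {n ∸ s} {s} (ℕ.m∸n+n≡m s≤n) (toℕ<n x))
                               (unshift {n ∸ s} {s} (ℕ.m∸n+n≡m s≤n) (toℕ<n y)) (sucMod-shift s {index x} {index y} h)
    rotate : ∀ {x y} → SucMod (toℕ x) (toℕ y) ⊎ SucMod (toℕ y) (toℕ x) → SucMod (index x) (index y) ⊎ SucMod (index y) (index x)
    rotate {x} {y} = Data.Sum.map (forward x y) (forward y x)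
    unrotate : ∀ {x y} → SucMod (index x) (index y) ⊎ SucMod (index y) (index x) → SucMod (toℕ x) (toℕ y) ⊎ SucMod (toℕ y) (toℕ x)
    unrotate {x} {y} = Data.Sum.map (back x y) (back y x)

  Cyc-bounded : Bounded n Cyc
  Cyc-bounded (inj₁ adj) = Adj-bounded {path} (ℕ.≤-reflexive (ℕ.+-identityʳ n)) adj
  Cyc-bounded (inj₂ (inj₁ (refl , refl))) = ℕ.≤-refl , s≤s z≤n
  Cyc-bounded (inj₂ (inj₂ (refl , refl))) = s≤s z≤n , ℕ.≤-refl

  path-no-wrap : ∀ {p q} → Adj (edge path) p q → ¬ SamePair N 0 p q
  path-no-wrap (inj₁ (() , _)) (inj₁ (refl , refl))
  path-no-wrap (inj₁ (refl , h)) (inj₂ (refl , ()))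
  path-no-wrap (inj₂ (refl , h)) (inj₁ (refl , ()))

  cycle-wellFormed : WellFormed (C n)
  cycle-wellFormed _ _ _ = refl

  F₀ : Frame n
  F₀ = rotation 0 z≤n

  lastVertex : Fin n
  lastVertex = Frame.vertex F₀ N

  index-last : Frame.index F₀ lastVertex ≡ N
  index-last = Frame.index-vertex F₀ ℕ.≤-refl

  last-leftAvail′ : LeftAvail′ Cyc N
  last-leftAvail′ = (0 , inj₂ (inj₁ (refl , refl))) , other
    where
    other : ∀ q → Cyc N q → HasOtherNbr′ Cyc q N
    other q (inj₁ (inj₁ (refl , h)))  = ⊥-elim (ℕ.<-irrefl refl (to path-edge h))
    other q (inj₁ (inj₂ (refl , h)))  = k , n≢2+n , inj₁ (inj₂ (refl , from path-edge (ℕ.n≤1+n _)))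
    other q (inj₂ (inj₁ (_ , refl)))  = 1 , (λ ()) , inj₁ (inj₁ (refl , refl))
    other q (inj₂ (inj₂ (() , _)))

  cycle-leftAvail : LeftAvail (C n) lastVertex
  cycle-leftAvail = leftAvail F₀ cycle-wellFormed (cycle-represented 0 z≤n) Cyc-bounded lastVertex
                      (subst (LeftAvail′ Cyc) (sym index-last) last-leftAvail′)

  cycle-rightHasMove : RightHasMove (C n)
  cycle-rightHasMove = rightHasMove F₀ (cycle-represented 0 z≤n) Cyc-bounded {0} {1}
    (inj₁ (inj₁ (refl , refl)) , (N , (λ ()) , inj₂ (inj₂ (refl , refl))) , (2 , (λ ()) , inj₁ (inj₁ (refl , refl))))

  afterDeletion : List ℕ
  afterDeletion = N ∷ 1 ∷ 0 ∷ []

  afterDeletion-models : Models F₀ afterDeletion (delV (C n) lastVertex)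
  afterDeletion-models = record
    { wellFormed = wellFormed-delV lastVertex cycle-wellFormed
    ; represents = represents-cong F₀
                     (λ x y → ⇔-trans (minus-last _ _) (⇔-sym (Adj-dropVertex {edge path} {edge afterDeletion} drops _ _)))
                     (subst (λ z → Represents F₀ (Cyc ─ᵛ z) (delV (C n) lastVertex)) index-last
                       (represents-delV F₀ lastVertex (cycle-represented 0 z≤n)))
    ; fits       = ℕ.≤-reflexive (ℕ.+-comm N 1) }
    where
    drops : ∀ w → edge afterDeletion w ≡ dropVertex (edge path) N w
    drops = subst (λ j → ∀ w → edge afterDeletion w ≡ dropVertex (edge (j ∷ [])) N w) (ℕ.+-comm N 1)
                  (edge-delete N 0 [])
    minus-last : ∀ p q → (Cyc ─ᵛ N) p q ⇔ (Adj (edge path) ─ᵛ N) p q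
    minus-last p q = mk⇔
      (λ { (inj₁ adj , ns) → adj , ns
         ; (inj₂ (inj₁ (e , _)) , p≢N , _) → ⊥-elim (p≢N e)
         ; (inj₂ (inj₂ (_ , e)) , _ , q≢N) → ⊥-elim (q≢N e) })
      (λ (adj , ns) → inj₁ adj , ns)

  wrapFrame : ∀ a b → SucMod (toℕ a) (toℕ b) →
              Σ (Frame n) λ F → Represents F Cyc (C n) × Frame.index F a ≡ N × Frame.index F b ≡ 0
  wrapFrame a b s = F , cycle-represented (toℕ b) b≤n , index-a , index-b
    where
    b≤n = ℕ.<⇒≤ (toℕ<n b)
    F = rotation (toℕ b) b≤n
    open Frame F
    index-b : index b ≡ 0
    index-b = trans (cong (_% n) (ℕ.m+[n∸m]≡n b≤n)) (n%n≡0 n)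
    index-a : index a ≡ N
    index-a with to (sucMod⇔ (m%n<n (toℕ a + (n ∸ toℕ b)) n) (s≤s z≤n))
                    (subst (SucMod (index a)) index-b (sucMod-shift (n ∸ toℕ b) {toℕ a} {toℕ b} s))
    ... | inj₁ ()
    ... | inj₂ (e , _) = e

  cutFrame : ∀ u v → RightAvail (C n) u v →
             Σ (Frame n) λ F → Represents F Cyc (C n) × SamePair N 0 (Frame.index F u) (Frame.index F v)
  cutFrame u v (e , _) with to (Cyc⇔sucMod (toℕ<n u) (toℕ<n v)) (to (cycAdj⇔Cyc (toℕ<n u) (toℕ<n v)) e)
  ... | inj₁ s with wrapFrame u v s
  ...   | F , R , iu , iv = F , R , inj₁ (iu , iv)
  cutFrame u v _ | inj₂ s with wrapFrame v u s
  ...   | F , R , iv , iu = F , R , inj₂ (iu , iv)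

  afterCut-models : ∀ {F} u v → Represents F Cyc (C n) → SamePair N 0 (Frame.index F u) (Frame.index F v) →
                    Models F path (delE (C n) u v)
  afterCut-models {F} u v R pair = record
    { wellFormed = wellFormed-delE u v cycle-wellFormed
    ; represents = represents-cong F (λ x y → ⇔-trans (─ᵉ-cong {Cyc} pair _ _) minus-wrap) (represents-delE F u v R)
    ; fits       = ℕ.≤-reflexive (ℕ.+-identityʳ n) }
    where
    minus-wrap : ∀ {p q} → (Cyc ─ᵉ (N , 0)) p q ⇔ Adj (edge path) p q
    minus-wrap = mk⇔ (λ { (inj₁ adj , _) → adj ; (inj₂ w , ¬w) → ⊥-elim (¬w w) })
                     (λ adj → inj₁ adj , path-no-wrap adj)

theorem3p19 : (n : ℕ) → 10 ≤ n → LeftWinsL (C n) × LeftWinsR (C n)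
theorem3p19 n 10≤n with ℕ.m≤n⇒∃[o]m+o≡n 10≤n
... | K , refl = leftFirst , rightFirst
  where
  open Cycle (7 + K)
  leftFirst : LeftWinsL (C (10 + K))
  leftFirst = leftMove cycle-rightHasMove lastVertex cycle-leftAvail
                (leftWinsR F₀ _ afterDeletion afterDeletion-models ℕ.≤-refl λ ())
  rightFirst : LeftWinsR (C (10 + K))
  rightFirst = allRight λ u v avail → let F , R , pair = cutFrame u v avail in
    leftWinsL F _ path (afterCut-models u v R pair) ℕ.≤-refl λ ()
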